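{- Let $\mathbb{L}'$ be a variable-restricted layer system that weakly layers a TRS $\mathcal{R}$. Then $\mathbb{L}'\cap\mathcal{T}(\mathcal{F},\mathcal{V})$ is closed under rewriting by $\mathcal{R}$.
   Context: Let $\mathcal{F}$ be a signature and $\mathcal{V}$ a countably infinite set of variables. $\square$ is a fresh constant (the hole). Contexts are the elements of $\mathcal{C}(\mathcal{F},\mathcal{V})=\mathcal{T}(\mathcal{F}\cup\{\square\},\mathcal{V})$. $\sqsubseteq$ is the smallest reflexive, transitive, monotone relation on contexts with $\square\sqsubseteq C$ for all $C$. $\sqcup$ is the least upper bound, when it exists. $\mathrm{Pos}_{\mathcal{F}}(C)$ is the set of positions of $C$ carrying a symbol of $\mathcal{F}$. Rules $\ell\to r$ satisfy $\ell\notin\mathcal{V}$ and $\mathrm{Var}(r)\subseteq\mathrm{Var}(\ell)$. Rewriting is extended to contexts by treating $\square$ as a constant. For $\mathbb{L}\subseteq\mathcal{C}(\mathcal{F},\mathcal{V})$, a top of $C$ is an $L\in\mathbb{L}$ with $L\sqsubseteq C$. A max-top is a $\sqsubseteq$-maximal top. $\mathbb{L}'$ is a variable-restricted layer system if: (L1) every term in $\mathcal{T}(\mathcal{F},\mathcal{V})$ has a top other than $\square$; (L2$'$) if $C[x]_p\in\mathbb{L}'$ with $x\in\mathcal{V}$ then $C[\square]_p\in\mathbb{L}'$, and if $C[\square]_p\in\mathbb{L}'$ then $\{x\in\mathcal{V}\mid C[x]_p\in\mathbb{L}'\}$ is infinite; (L3) if $L,N\in\mathbb{L}'$, $p\in\mathrm{Pos}_{\mathcal{F}}(L)$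 and $L|_p\sqcup N$ is defined, then $L[L|_p\sqcup N]_p\in\mathbb{L}'$. $\mathbb{L}'$ weakly layers $\mathcal{R}$ if every rule $\ell\to r\in\mathcal{R}$ satisfies: (W) whenever $M$ is a max-top of a term $s$, $p\in\mathrm{Pos}_{\mathcal{F}}(M)$ and $s\to_{p,\ell\to r}t$, then $M\to_{p,\ell\to r}L$ for some $L\in\mathbb{L}'$. -}

module Defs where

open import Data.Nat using (ℕ; zero; suc; _≥_)
open import Data.List using (List; []; _∷_)
open import Data.Vec using (Vec; []; _∷_; lookup; _[_]≔_)
open import Data.Fin using (Fin)
open import Data.Maybe using (Maybe; just; nothing)
open import Data.Product using (Σ; ∃; ∃-syntax; _×_; _,_)
open import Relation.Binary.PropositionalEquality using (_≡_; _≢_)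
open import Relation.Nullary using (¬_)

record Signature : Set₁ where
  field
    Fun   : Set
    arity : Fun → ℕ

Var : Set
Var = ℕ

-- Positions: lists of argument indices (0-based).
Pos : Set
Pos = List ℕ

module _ (Sig : Signature) where
  open Signature Sig

  -- Contexts 𝒞(ℱ,𝒱) = 𝒯(ℱ ∪ {□}, 𝒱).
  data Ctx : Set where
    hole : Ctx
    var  : Var → Ctx
    fun  : (f : Fun) → Vec Ctx (arity f) → Ctx

  mutual
    _at_ : Ctx → Pos → Maybe Ctx
    C at [] = just C
    hole at (_ ∷ _) = nothing
    var _ at (_ ∷ _) = nothing
    fun f cs at (i ∷ p) = atV cs i p

    atV : ∀ {n} → Vec Ctx n → ℕ → Pos → Maybe Ctx
    atV [] _ _ = nothing
    atV (c ∷ cs) zero p = c at p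
    atV (c ∷ cs) (suc i) p = atV cs i p

  -- replacement C[D]_p (identity if p is not a position of C)
  mutual
    replace : Ctx → Pos → Ctx → Ctx
    replace C [] D = D
    replace hole (_ ∷ _) D = hole
    replace (var x) (_ ∷ _) D = var x
    replace (fun f cs) (i ∷ p) D = fun f (replaceV cs i p D)

    replaceV : ∀ {n} → Vec Ctx n → ℕ → Pos → Ctx → Vec Ctx n
    replaceV [] _ _ _ = []
    replaceV (c ∷ cs) zero p D = replace c p D ∷ cs
    replaceV (c ∷ cs) (suc i) p D = c ∷ replaceV cs i p D

  -- applying a substitution σ : 𝒱 → 𝒞 (□ is treated as a constant)
  mutual
    _⟨_⟩ : Ctx → (Var → Ctx) → Ctx
    hole ⟨ σ ⟩ = hole
    var x ⟨ σ ⟩ = σ x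
    fun f cs ⟨ σ ⟩ = fun f (substV cs σ)

    substV : ∀ {n} → Vec Ctx n → (Var → Ctx) → Vec Ctx n
    substV [] σ = []
    substV (c ∷ cs) σ = (c ⟨ σ ⟩) ∷ substV cs σ

  IsPos : Ctx → Pos → Set
  IsPos C p = ∃[ D ] (C at p ≡ just D)

  IsFunPos : Ctx → Pos → Set
  IsFunPos C p = ∃[ f ] ∃[ cs ] (C at p ≡ just (fun f cs))

  Occurs : Var → Ctx → Set
  Occurs x C = ∃[ p ] (C at p ≡ just (var x))

  IsTerm : Ctx → Set
  IsTerm C = ∀ p → C at p ≢ just hole

  data _⊑_ : Ctx → Ctx → Set where
    ⊑-refl  : ∀ {C} → C ⊑ C
    ⊑-trans : ∀ {A B C} → A ⊑ B → B ⊑ C → A ⊑ C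
    ⊑-hole  : ∀ {C} → hole ⊑ C
    ⊑-mono  : ∀ {f} (cs : Vec Ctx (arity f)) (i : Fin (arity f)) {D} →
              lookup cs i ⊑ D → fun f cs ⊑ fun f (cs [ i ]≔ D)

  IsLub : Ctx → Ctx → Ctx → Set
  IsLub A B E = A ⊑ E × B ⊑ E × (∀ U → A ⊑ U → B ⊑ U → E ⊑ U)

  record Rule : Set where
    field
      lhs      : Ctx
      rhs      : Ctx
      lhs-term : IsTerm lhs
      rhs-term : IsTerm rhs
      lhs-nonvar : ∀ x → lhs ≢ var x
      vars⊆    : ∀ x → Occurs x rhs → Occurs x lhs
  open Rule public

  StepAt : Pos → Rule → Ctx → Ctx → Set
  StepAt p ρ s t = ∃[ σ ] (s at p ≡ just (lhs ρ ⟨ σ ⟩) × t ≡ replace s p (rhs ρ ⟨ σ ⟩))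

  Step : (Rule → Set) → Ctx → Ctx → Set
  Step R s t = ∃[ ρ ] ∃[ p ] (R ρ × StepAt p ρ s t)

  module _ (𝕃 : Ctx → Set) where
    IsTop : Ctx → Ctx → Set
    IsTop L C = 𝕃 L × L ⊑ C

    IsMaxTop : Ctx → Ctx → Set
    IsMaxTop M C = IsTop M C × (∀ L → IsTop L C → M ⊑ L → L ≡ M)

    -- an infinite set of variables: unbounded subset of ℕ
    InfiniteVars : (Var → Set) → Set
    InfiniteVars P = ∀ n → ∃[ x ] (x ≥ n × P x)

    record VarRestrictedLayerSystem : Set where
      field
        L1  : ∀ t → IsTerm t → ∃[ L ] (IsTop L t × L ≢ hole)
        L2a : ∀ C p x → IsPos C p → 𝕃 (replace C p (var x)) → 𝕃 (replace C p hole)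
        L2b : ∀ C p → IsPos C p → 𝕃 (replace C p hole) →
              InfiniteVars (λ x → 𝕃 (replace C p (var x)))
        L3  : ∀ L N p → 𝕃 L → 𝕃 N → IsFunPos L p →
              ∀ Lp E → L at p ≡ just Lp → IsLub Lp N E → 𝕃 (replace L p E)

    WeaklyLayers : (Rule → Set) → Set
    WeaklyLayers R = ∀ ρ → R ρ → ∀ s M p t → IsTerm s → IsMaxTop M s → IsFunPos M p →
                     StepAt p ρ s t → ∃[ L ] (𝕃 L × StepAt p ρ M L)

module Submission where

-- Let s ∈ 𝕃 be a term and s →_{p,ρ} t.  Since ⊑ is antisymmetric, s is a
-- max-top of itself, and p is a function position of s because the left-hand
-- side of ρ is not a variable.  Condition (W) thus yields M = s →_{p,ρ} L with
-- L ∈ 𝕃.  A rewrite step at a fixed position with a fixed rule is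
-- deterministic (the matching substitution is unique on Var(ℓ) ⊇ Var(r)),
-- so t = L ∈ 𝕃.  Independently, a step with a hole-free rule never creates
-- a hole, so t is again a term.

open import Defs
open import Data.Nat using (zero; suc)
open import Data.List using ([]; _∷_)
open import Data.Vec using (Vec; []; _∷_; lookup; _[_]≔_)
open import Data.Fin using (Fin)
open import Data.Maybe using (Maybe; just)
open import Data.Maybe.Properties using (just-injective)
open import Data.Product using (_×_; ∃-syntax; _,_)
open import Data.Empty using (⊥-elim)
open import Relation.Binary.PropositionalEquality
  using (_≡_; _≢_; refl; sym; trans; cong; cong₂; subst)

module Theory (Sig : Signature) where
  open Signature Sig

  private
    𝒞 : Set
    𝒞 = Ctx Sig

    _∣_ : 𝒞 → Pos → Maybe 𝒞
    _∣_ = _at_ Sig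

    _⟪_⟫ : 𝒞 → (Var → 𝒞) → 𝒞
    _⟪_⟫ = _⟨_⟩ Sig

  mutual
    subst-at-var : ∀ (c : 𝒞) q x σ → c ∣ q ≡ just (var x) → (c ⟪ σ ⟫) ∣ q ≡ just (σ x)
    subst-at-var c          []      x σ refl = refl
    subst-at-var (fun f cs) (i ∷ q) x σ e    = subst-at-varV cs i q x σ e

    subst-at-varV : ∀ {n} (cs : Vec 𝒞 n) i q x σ → atV Sig cs i q ≡ just (var x) →
                    atV Sig (substV Sig cs σ) i q ≡ just (σ x)
    subst-at-varV (c ∷ cs) zero    q x σ e = subst-at-var c q x σ e
    subst-at-varV (c ∷ cs) (suc i) q x σ e = subst-at-varV cs i q x σ e

  mutual
    subst-cong : ∀ (c : 𝒞) σ σ′ → (∀ x → Occurs Sig x c → σ x ≡ σ′ x) → c ⟪ σ ⟫ ≡ c ⟪ σ′ ⟫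
    subst-cong hole       σ σ′ agree = refl
    subst-cong (var x)    σ σ′ agree = agree x ([] , refl)
    subst-cong (fun f cs) σ σ′ agree =
      cong (fun f) (subst-congV cs σ σ′ λ x i (q , e) → agree x (i ∷ q , e))

    subst-congV : ∀ {n} (cs : Vec 𝒞 n) σ σ′ →
                  (∀ x i → ∃[ q ] (atV Sig cs i q ≡ just (var x)) → σ x ≡ σ′ x) →
                  substV Sig cs σ ≡ substV Sig cs σ′
    subst-congV []       σ σ′ agree = refl
    subst-congV (c ∷ cs) σ σ′ agree =
      cong₂ _∷_ (subst-cong c σ σ′ λ x occ → agree x zero occ)
                (subst-congV cs σ σ′ λ x i occ → agree x (suc i) occ)

  subst-injective-on-vars : ∀ (c : 𝒞) σ σ′ → c ⟪ σ ⟫ ≡ c ⟪ σ′ ⟫ →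
                            ∀ x → Occurs Sig x c → σ x ≡ σ′ x
  subst-injective-on-vars c σ σ′ eq x (q , e) = just-injective occurrence-images
    where
    occurrence-images : just (σ x) ≡ just (σ′ x)
    occurrence-images = trans (sym (subst-at-var c q x σ e))
                        (trans (cong (_∣ q) eq) (subst-at-var c q x σ′ e))

  step-deterministic : ∀ {p ρ s t u} → StepAt Sig p ρ s t → StepAt Sig p ρ s u → t ≡ u
  step-deterministic {p} {ρ} {s} (σ , at-s , refl) (σ′ , at-s′ , refl) =
    cong (replace Sig s p) (subst-cong (rhs ρ) σ σ′ agree-on-rhs)
    where
    same-redex : lhs ρ ⟪ σ ⟫ ≡ lhs ρ ⟪ σ′ ⟫
    same-redex = just-injective (trans (sym at-s) at-s′)

    agree-on-rhs : ∀ x → Occurs Sig x (rhs ρ) → σ x ≡ σ′ x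
    agree-on-rhs x occ = subst-injective-on-vars (lhs ρ) σ σ′ same-redex x (vars⊆ ρ x occ)

  -- Since ℓ is neither a variable nor contains □, a redex position carries
  -- a function symbol.
  redex-funPos : ∀ {p ρ s t} → StepAt Sig p ρ s t → IsFunPos Sig s p
  redex-funPos {ρ = ρ} (σ , at-s , _) with lhs ρ | lhs-term ρ | lhs-nonvar ρ
  ... | hole     | hole-free | _      = ⊥-elim (hole-free [] refl)
  ... | var x    | _         | nonvar = ⊥-elim (nonvar x refl)
  ... | fun f cs | _         | _      = f , substV Sig cs σ , at-s

  mutual
    data _≤_ : 𝒞 → 𝒞 → Set where
      hole≤ : ∀ {c} → hole ≤ c
      var≤  : ∀ {x} → var x ≤ var x
      fun≤  : ∀ {f cs ds} → cs ≤ⱽ ds → fun f cs ≤ fun f ds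

    data _≤ⱽ_ : ∀ {n} → Vec 𝒞 n → Vec 𝒞 n → Set where
      []  : [] ≤ⱽ []
      _∷_ : ∀ {n c d} {cs ds : Vec 𝒞 n} → c ≤ d → cs ≤ⱽ ds → (c ∷ cs) ≤ⱽ (d ∷ ds)

  -- ≤ is a partial order; antisymmetry is what ⊑ lacks syntactically.
  mutual
    ≤-refl : ∀ c → c ≤ c
    ≤-refl hole       = hole≤
    ≤-refl (var x)    = var≤
    ≤-refl (fun f cs) = fun≤ (≤ⱽ-refl cs)

    ≤ⱽ-refl : ∀ {n} (cs : Vec 𝒞 n) → cs ≤ⱽ cs
    ≤ⱽ-refl []       = []
    ≤ⱽ-refl (c ∷ cs) = ≤-refl c ∷ ≤ⱽ-refl cs

  mutual
    ≤-trans : ∀ {a b c} → a ≤ b → b ≤ c → a ≤ c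
    ≤-trans hole≤    _        = hole≤
    ≤-trans var≤     var≤     = var≤
    ≤-trans (fun≤ p) (fun≤ q) = fun≤ (≤ⱽ-trans p q)

    ≤ⱽ-trans : ∀ {n} {as bs cs : Vec 𝒞 n} → as ≤ⱽ bs → bs ≤ⱽ cs → as ≤ⱽ cs
    ≤ⱽ-trans []       []       = []
    ≤ⱽ-trans (p ∷ ps) (q ∷ qs) = ≤-trans p q ∷ ≤ⱽ-trans ps qs

  mutual
    ≤-antisym : ∀ {a b} → a ≤ b → b ≤ a → a ≡ b
    ≤-antisym hole≤    hole≤    = refl
    ≤-antisym var≤     var≤     = refl
    ≤-antisym (fun≤ p) (fun≤ q) = cong (fun _) (≤ⱽ-antisym p q)

    ≤ⱽ-antisym : ∀ {n} {as bs : Vec 𝒞 n} → as ≤ⱽ bs → bs ≤ⱽ as → as ≡ bs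
    ≤ⱽ-antisym []       []       = refl
    ≤ⱽ-antisym (p ∷ ps) (q ∷ qs) = cong₂ _∷_ (≤-antisym p q) (≤ⱽ-antisym ps qs)

  ≤ⱽ-update : ∀ {n} (cs : Vec 𝒞 n) (i : Fin n) {d} → lookup cs i ≤ d → cs ≤ⱽ (cs [ i ]≔ d)
  ≤ⱽ-update (c ∷ cs) Fin.zero    c≤d = c≤d ∷ ≤ⱽ-refl cs
  ≤ⱽ-update (c ∷ cs) (Fin.suc i) c≤d = ≤-refl c ∷ ≤ⱽ-update cs i c≤d

  ⊑⇒≤ : ∀ {a b} → _⊑_ Sig a b → a ≤ b
  ⊑⇒≤ ⊑-refl             = ≤-refl _
  ⊑⇒≤ (⊑-trans p q)      = ≤-trans (⊑⇒≤ p) (⊑⇒≤ q)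
  ⊑⇒≤ ⊑-hole             = hole≤
  ⊑⇒≤ (⊑-mono cs i c⊑d)  = fun≤ (≤ⱽ-update cs i (⊑⇒≤ c⊑d))

  ⊑-antisym : ∀ {a b} → _⊑_ Sig a b → _⊑_ Sig b a → a ≡ b
  ⊑-antisym a⊑b b⊑a = ≤-antisym (⊑⇒≤ a⊑b) (⊑⇒≤ b⊑a)

  self-maxTop : ∀ (𝕃 : 𝒞 → Set) {s} → 𝕃 s → IsMaxTop Sig 𝕃 s s
  self-maxTop 𝕃 𝕃s = (𝕃s , ⊑-refl) , λ L (_ , L⊑s) s⊑L → ⊑-antisym L⊑s s⊑L

  mutual
    data HoleFree : 𝒞 → Set where
      var : ∀ x → HoleFree (var x)
      fun : ∀ f {cs} → HoleFreeⱽ cs → HoleFree (fun f cs)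

    data HoleFreeⱽ : ∀ {n} → Vec 𝒞 n → Set where
      []  : HoleFreeⱽ []
      _∷_ : ∀ {n c} {cs : Vec 𝒞 n} → HoleFree c → HoleFreeⱽ cs → HoleFreeⱽ (c ∷ cs)

  mutual
    IsTerm⇒HoleFree : ∀ c → IsTerm Sig c → HoleFree c
    IsTerm⇒HoleFree hole       noHole = ⊥-elim (noHole [] refl)
    IsTerm⇒HoleFree (var x)    noHole = var x
    IsTerm⇒HoleFree (fun f cs) noHole = fun f (IsTerm⇒HoleFreeⱽ cs λ i q → noHole (i ∷ q))

    IsTerm⇒HoleFreeⱽ : ∀ {n} (cs : Vec 𝒞 n) → (∀ i q → atV Sig cs i q ≢ just hole) →
                       HoleFreeⱽ cs
    IsTerm⇒HoleFreeⱽ []       noHole = []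
    IsTerm⇒HoleFreeⱽ (c ∷ cs) noHole =
      IsTerm⇒HoleFree c (noHole zero) ∷ IsTerm⇒HoleFreeⱽ cs λ i → noHole (suc i)

  mutual
    HoleFree⇒IsTerm : ∀ {c} → HoleFree c → IsTerm Sig c
    HoleFree⇒IsTerm (var x)    []      ()
    HoleFree⇒IsTerm (var x)    (_ ∷ _) ()
    HoleFree⇒IsTerm (fun f hs) []      ()
    HoleFree⇒IsTerm (fun f hs) (i ∷ q) = HoleFree⇒IsTermⱽ hs i q

    HoleFree⇒IsTermⱽ : ∀ {n} {cs : Vec 𝒞 n} → HoleFreeⱽ cs → ∀ i q → atV Sig cs i q ≢ just hole
    HoleFree⇒IsTermⱽ (h ∷ hs) zero    q = HoleFree⇒IsTerm h q
    HoleFree⇒IsTermⱽ (h ∷ hs) (suc i) q = HoleFree⇒IsTermⱽ hs i q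

  mutual
    subterm-holeFree : ∀ {c} → HoleFree c → ∀ q {d} → c ∣ q ≡ just d → HoleFree d
    subterm-holeFree h          []      refl = h
    subterm-holeFree (fun f hs) (i ∷ q) e    = subterm-holeFreeⱽ hs i q e

    subterm-holeFreeⱽ : ∀ {n} {cs : Vec 𝒞 n} → HoleFreeⱽ cs →
                        ∀ i q {d} → atV Sig cs i q ≡ just d → HoleFree d
    subterm-holeFreeⱽ (h ∷ hs) zero    q e = subterm-holeFree h q e
    subterm-holeFreeⱽ (h ∷ hs) (suc i) q e = subterm-holeFreeⱽ hs i q e

  mutual
    replace-holeFree : ∀ {c d} → HoleFree c → HoleFree d → ∀ q → HoleFree (replace Sig c q d)
    replace-holeFree hc         hd []      = hd
    replace-holeFree (var x)    hd (i ∷ q) = var x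
    replace-holeFree (fun f hs) hd (i ∷ q) = fun f (replace-holeFreeⱽ hs hd i q)

    replace-holeFreeⱽ : ∀ {n} {cs : Vec 𝒞 n} {d} → HoleFreeⱽ cs → HoleFree d →
                        ∀ i q → HoleFreeⱽ (replaceV Sig cs i q d)
    replace-holeFreeⱽ []       hd i       q = []
    replace-holeFreeⱽ (h ∷ hs) hd zero    q = replace-holeFree h hd q ∷ hs
    replace-holeFreeⱽ (h ∷ hs) hd (suc i) q = h ∷ replace-holeFreeⱽ hs hd i q

  mutual
    subst-holeFree : ∀ {c} → HoleFree c → ∀ σ → (∀ x → Occurs Sig x c → HoleFree (σ x)) →
                     HoleFree (c ⟪ σ ⟫)
    subst-holeFree (var x)    σ hσ = hσ x ([] , refl)
    subst-holeFree (fun f hs) σ hσ = fun f (subst-holeFreeⱽ hs σ λ x i (q , e) → hσ x (i ∷ q , e))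

    subst-holeFreeⱽ : ∀ {n} {cs : Vec 𝒞 n} → HoleFreeⱽ cs → ∀ σ →
                      (∀ x i → ∃[ q ] (atV Sig cs i q ≡ just (var x)) → HoleFree (σ x)) →
                      HoleFreeⱽ (substV Sig cs σ)
    subst-holeFreeⱽ []       σ hσ = []
    subst-holeFreeⱽ (h ∷ hs) σ hσ =
      subst-holeFree h σ (λ x occ → hσ x zero occ) ∷ subst-holeFreeⱽ hs σ λ x i occ → hσ x (suc i) occ

  -- A rewrite step maps terms to terms: the matching substitution sends
  -- Var(ℓ) ⊇ Var(r) to subterms of the (hole-free) redex.
  step-preserves-IsTerm : ∀ {p ρ s t} → IsTerm Sig s → StepAt Sig p ρ s t → IsTerm Sig t
  step-preserves-IsTerm {p} {ρ} {s} s-term (σ , at-s , refl) =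
    HoleFree⇒IsTerm (replace-holeFree s-hf contractum-hf p)
    where
    s-hf : HoleFree s
    s-hf = IsTerm⇒HoleFree s s-term

    redex-hf : HoleFree (lhs ρ ⟪ σ ⟫)
    redex-hf = subterm-holeFree s-hf p at-s

    σ-hf-on-lhs : ∀ x → Occurs Sig x (lhs ρ) → HoleFree (σ x)
    σ-hf-on-lhs x (q , e) = subterm-holeFree redex-hf q (subst-at-var (lhs ρ) q x σ e)

    contractum-hf : HoleFree (rhs ρ ⟪ σ ⟫)
    contractum-hf = subst-holeFree (IsTerm⇒HoleFree (rhs ρ) (rhs-term ρ)) σ
                      λ x occ → σ-hf-on-lhs x (vars⊆ ρ x occ)

open Theory

lemma6p10 : (Sig : Signature) (R : Rule Sig → Set) (𝕃 : Ctx Sig → Set) →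
    VarRestrictedLayerSystem Sig 𝕃 → WeaklyLayers Sig 𝕃 R →
    ∀ s t → 𝕃 s → IsTerm Sig s → Step Sig R s t → 𝕃 t × IsTerm Sig t
lemma6p10 Sig R 𝕃 _ weakly s t 𝕃s s-term (ρ , p , ρ∈R , s→t)
  with weakly ρ ρ∈R s s p t s-term (self-maxTop Sig 𝕃 𝕃s) (redex-funPos Sig {p} {ρ} s→t) s→t
... | L , 𝕃L , s→L =
  subst 𝕃 (sym (step-deterministic Sig {p} {ρ} s→t s→L)) 𝕃L ,
  step-preserves-IsTerm Sig {p} {ρ} s-term s→t
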